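{- Let $L/K$ be a finite Galois extension of fields with nonabelian Galois group $G$, let $N$ be a regular subgroup of $\mathrm{Perm}(G)$ normalized by $\lambda(G)$, and let $x\in L$. Then $f_x=\sum_{g\in G}g(x)u_g$ is an $L[N]$-generator of $GL$ (i.e. $GL=L[N]\cdot f_x$) if and only if the matrix $T_N(x)=\big(\eta(g)[x]\big)_{\eta\in N,\,g\in G}$ is nonsingular, where $\eta(g)\in G$ and $\eta(g)[x]$ denotes the Galois automorphism $\eta(g)$ applied to $x$.
   Context: $\lambda: G\to\mathrm{Perm}(G)$ is the left regular embedding $\lambda(g)(h)=gh$. $GL=\mathrm{Map}(G,L)$ is the $L$-algebra of functions $G\to L$, with $L$-basis of orthogonal idempotents $u_g$ defined by $u_g(\sigma)=\delta_{g,\sigma}$. $N$ acts on $GL$ by $\eta\cdot u_g=u_{\eta(g)}$, extended $L$-linearly, making $GL$ an $L[N]$-module. -}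

module Defs where

open import Level using (Level; _⊔_) renaming (suc to lsuc)
open import Data.Nat using (ℕ)
open import Data.Fin using (Fin; zero; suc)
open import Data.Product using (Σ; ∃; _×_; _,_)
open import Relation.Nullary using (¬_)
open import Relation.Binary.PropositionalEquality using (_≡_; _≢_)
open import Algebra.Bundles using (CommutativeRing)
open import Algebra.Structures using (IsGroup)
open import Algebra.Morphism.Structures using (module RingMorphisms)
open import Data.Fin.Permutation using (Permutation′; _⟨$⟩ʳ_; _⟨$⟩ˡ_)

record Field (c ℓ : Level) : Set (lsuc (c ⊔ ℓ)) where
  field
    commutativeRing : CommutativeRing c ℓ
  open CommutativeRing commutativeRing public
  field
    0≉1     : ¬ (0# ≈ 1#)
    inverse : ∀ x → ¬ (x ≈ 0#) → ∃ λ y → (x * y) ≈ 1#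

record FinGroup (n : ℕ) : Set where
  field
    _∙_     : Fin n → Fin n → Fin n
    ε       : Fin n
    _⁻¹     : Fin n → Fin n
    isGroup : IsGroup _≡_ _∙_ ε _⁻¹

NonAbelian : ∀ {n} → FinGroup n → Set
NonAbelian G = ∃ λ a → ∃ λ b → (a ∙ b) ≢ (b ∙ a)
  where open FinGroup G

-- Finite Galois extension L/K with Galois group G:
-- G acts faithfully on the field L by field automorphisms; K is the
-- fixed field L^G (by Artin's theorem L/L^G is finite Galois with
-- group G, and every finite Galois extension arises this way).

module _ {c ℓ : Level} (L : Field c ℓ) where
  open Field L hiding (zero)

  open RingMorphisms rawRing rawRing using (IsRingIsomorphism)

  record GaloisAction {n : ℕ} (G : FinGroup n) : Set (c ⊔ ℓ) where
    open FinGroup G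
    field
      act     : Fin n → Carrier → Carrier
      isAuto  : ∀ g → IsRingIsomorphism (act g)
      act-∙   : ∀ g h x → act (g ∙ h) x ≈ act g (act h x)
      act-ε   : ∀ x → act ε x ≈ x
      faithful : ∀ g → (∀ x → act g x ≈ x) → g ≡ ε

  Σ[_] : ∀ k → (Fin k → Carrier) → Carrier
  Σ[ ℕ.zero ] f = 0#
  Σ[ ℕ.suc k ] f = f zero + Σ[ k ] (λ i → f (suc i))

  Matrix : ℕ → ℕ → Set c
  Matrix m k = Fin m → Fin k → Carrier

  _·ᴹ_ : ∀ {m k p} → Matrix m k → Matrix k p → Matrix m p
  _·ᴹ_ {k = k} A B i j = Σ[ k ] (λ l → A i l * B l j)

  IdentityMatrix : ∀ {m} → Matrix m m → Set ℓ
  IdentityMatrix {m} A = ∀ (i j : Fin m) →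
    (i ≡ j → A i j ≈ 1#) × (i ≢ j → A i j ≈ 0#)

  Nonsingular : ∀ {m k} → Matrix m k → Set (c ⊔ ℓ)
  Nonsingular {m} {k} A =
    Σ (Matrix k m) λ B → IdentityMatrix (A ·ᴹ B) × IdentityMatrix (B ·ᴹ A)

  -- GL = Map(G, L); u_g is the indicator function of g.
  GL : ℕ → Set c
  GL n = Fin n → Carrier

  -- permutation action on GL:  η · u_g = u_{η(g)}, extended L-linearly,
  -- i.e. (η · f)(h) = f(η⁻¹(h)).
  _•_ : ∀ {n} → Permutation′ n → GL n → GL n
  (η • f) h = f (η ⟨$⟩ˡ h)

  IsL[N]Generator : ∀ {n m} → (Fin m → Permutation′ n) → GL n → Set (c ⊔ ℓ)
  IsL[N]Generator {n} {m} ν f =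
    ∀ (F : GL n) → Σ (Fin m → Carrier) λ coeff →
      ∀ h → F h ≈ Σ[ m ] (λ i → coeff i * (ν i • f) h)

-- A regular subgroup N of Perm(G) normalized by λ(G), given by an
-- injective enumeration ν : Fin m → Perm(G) of its elements.

record RegularNormalizedSubgroup {n : ℕ} (G : FinGroup n) (m : ℕ) : Set where
  open FinGroup G
  field
    ν : Fin m → Permutation′ n
    ν-injective : ∀ i j → (∀ g → ν i ⟨$⟩ʳ g ≡ ν j ⟨$⟩ʳ g) → i ≡ j
    has-id   : ∃ λ k → ∀ g → ν k ⟨$⟩ʳ g ≡ g
    closed-∘ : ∀ i j → ∃ λ k → ∀ g → ν k ⟨$⟩ʳ g ≡ ν i ⟨$⟩ʳ (ν j ⟨$⟩ʳ g)
    closed-⁻¹ : ∀ i → ∃ λ k → ∀ g → ν k ⟨$⟩ʳ g ≡ ν i ⟨$⟩ˡ g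
    transitive : ∀ g h → ∃ λ i → ν i ⟨$⟩ʳ g ≡ h
    free       : ∀ i g → ν i ⟨$⟩ʳ g ≡ g → ∀ h → ν i ⟨$⟩ʳ h ≡ h
    -- normalized by λ(G): λ(g) ∘ η ∘ λ(g)⁻¹ ∈ N
    normalized : ∀ g i → ∃ λ k → ∀ h →
      ν k ⟨$⟩ʳ h ≡ g ∙ (ν i ⟨$⟩ʳ ((g ⁻¹) ∙ h))

module _ {c ℓ : Level} (L : Field c ℓ) {n : ℕ} {G : FinGroup n}
         (σ : GaloisAction L G) where
  open Field L using (Carrier)
  open GaloisAction σ

  f[_] : Carrier → GL L n
  f[ x ] g = act g x

  T[_]⟨_⟩ : ∀ {m} → RegularNormalizedSubgroup G m → Carrier → Matrix L m n
  T[ N ]⟨ x ⟩ i g = act (RegularNormalizedSubgroup.ν N i ⟨$⟩ʳ g) x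

module Submission where

-- Translating f_x by η ∈ N gives (η · f_x)(h) = f_x(η⁻¹ h) = (η⁻¹ h)[x], so the matrix whose
-- rows are the translates η · f_x is T_N(x) with its rows permuted by η ↦ η⁻¹; hence f_x
-- generates GL exactly when T_N(x) has a left inverse C.  As N is regular, η ↦ η(1) is a
-- bijection N → G, so T_N(x) is square.  Over any commutative ring, C T = 1 forces
-- det C · det T = 1 by multiplicativity of the determinant (a consequence of the uniqueness
-- of alternating multilinear forms), and then det C · adj T is a right inverse of T.
-- Determinants are used because equality in L is not decidable, which rules out elimination.

open import Level using (Level; _⊔_)
open import Data.Nat using (ℕ; zero; suc)
open import Data.Fin using (Fin; zero; suc; punchIn; punchOut; _≟_)
open import Data.Fin.Properties using (punchInᵢ≢i; punchIn-punchOut; suc-injective; cantor-schröder-bernstein)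
open import Data.Fin.Permutation using (Permutation′; _⟨$⟩ʳ_; _⟨$⟩ˡ_; permutation; inverseˡ; inverseʳ)
open import Data.Vec.Functional using (Vector; updateAt; insertAt; map; _∷_; tail)
open import Data.Vec.Functional.Properties
  using (updateAt-updates; updateAt-minimal; updateAt-id-local; updateAt-commutes; map-updateAt;
         insertAt-lookup; insertAt-punchIn)
open import Data.Empty using (⊥-elim)
open import Data.Product using (Σ; _,_; proj₁; proj₂)
open import Function using (const; _∘_)
open import Function.Bundles using (_⇔_; mk⇔)
open import Function.Properties.Equivalence using () renaming (trans to ⇔-trans; sym to ⇔-sym)
open import Relation.Binary.PropositionalEquality as ≡ using (_≡_; _≢_; _≗_)
open import Relation.Nullary using (Dec; yes; no)
open import Algebra.Bundles using (CommutativeRing)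

module Determinants {c ℓ : Level} (R : CommutativeRing c ℓ) where

  open CommutativeRing R hiding (zero)
  open import Algebra.Properties.Ring ring
    using (-‿distribʳ-*; -‿distribˡ-*; -0#≈0#; -‿+-comm; -‿involutive; +-inverseʳ-unique; x+x≈x⇒x≈0)
  open import Algebra.Properties.Semiring.Sum semiring
    using (sum; sum-cong-≋; sum-replicate-zero; ∑-distrib-+; ∑-comm; *-distribˡ-sum; *-distribʳ-sum; sum-permute)
  open import Algebra.Properties.CommutativeSemigroup *-commutativeSemigroup using (x∙yz≈y∙xz; x∙yz≈yx∙z)
  open import Relation.Binary.Reasoning.Setoid setoid

  -- Finite sums and matrices over a commutative ring

  -x*-y≈x*y : ∀ x y → - x * - y ≈ x * y
  -x*-y≈x*y x y = begin
    - x * - y     ≈⟨ -‿distribˡ-* x (- y) ⟨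
    - (x * - y)   ≈⟨ -‿cong (-‿distribʳ-* x y) ⟨
    - - (x * y)   ≈⟨ -‿involutive _ ⟩
    x * y         ∎

  x*[y*-z]≈-[x*[y*z]] : ∀ x y z → x * (y * - z) ≈ - (x * (y * z))
  x*[y*-z]≈-[x*[y*z]] x y z = trans (*-congˡ (sym (-‿distribʳ-* y z))) (sym (-‿distribʳ-* x _))

  -- Opaque so that unification can recover f from ∑ f: the library's sum unfolds on
  -- Fin (suc n), which blocks inference of implicit summands.
  opaque
    ∑ : ∀ {n} → Vector Carrier n → Carrier
    ∑ = sum

  opaque
    unfolding ∑

    ∑-suc : ∀ {n} (f : Vector Carrier (suc n)) → ∑ f ≈ f zero + ∑ (f ∘ suc)
    ∑-suc f = refl

    ∑-cong : ∀ {n} {f g : Vector Carrier n} → (∀ i → f i ≈ g i) → ∑ f ≈ ∑ g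
    ∑-cong = sum-cong-≋

    ∑-zero : ∀ {n} {f : Vector Carrier n} → (∀ i → f i ≈ 0#) → ∑ f ≈ 0#
    ∑-zero {n} f≈0 = trans (sum-cong-≋ f≈0) (sum-replicate-zero n)

    ∑-+ : ∀ {n} (f g : Vector Carrier n) → ∑ (λ i → f i + g i) ≈ ∑ f + ∑ g
    ∑-+ = ∑-distrib-+

    ∑-swap : ∀ {m n} (f : Fin m → Fin n → Carrier) → ∑ (λ i → ∑ (f i)) ≈ ∑ (λ j → ∑ (λ i → f i j))
    ∑-swap = ∑-comm

    *-distribˡ-∑ : ∀ {n} x (f : Vector Carrier n) → x * ∑ f ≈ ∑ (λ i → x * f i)
    *-distribˡ-∑ = *-distribˡ-sum

    *-distribʳ-∑ : ∀ {n} x (f : Vector Carrier n) → ∑ f * x ≈ ∑ (λ i → f i * x)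
    *-distribʳ-∑ = *-distribʳ-sum

    ∑-permute : ∀ {n} (f : Vector Carrier n) (π : Permutation′ n) → ∑ f ≈ ∑ (f ∘ (π ⟨$⟩ʳ_))
    ∑-permute = sum-permute

    -‿∑ : ∀ {n} (f : Vector Carrier n) → - ∑ f ≈ ∑ (λ i → - f i)
    -‿∑ {zero}  f = -0#≈0#
    -‿∑ {suc n} f = trans (sym (-‿+-comm _ _)) (+-congˡ (-‿∑ (f ∘ suc)))

  ∑-linear : ∀ {n} x y (f g : Vector Carrier n) → ∑ (λ i → x * f i + y * g i) ≈ x * ∑ f + y * ∑ g
  ∑-linear x y f g =
    trans (∑-+ (λ i → x * f i) (λ i → y * g i)) (sym (+-cong (*-distribˡ-∑ x f) (*-distribˡ-∑ y g)))

  δ : ∀ {n} → Fin n → Fin n → Carrier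
  δ zero    zero    = 1#
  δ zero    (suc j) = 0#
  δ (suc i) zero    = 0#
  δ (suc i) (suc j) = δ i j

  δ-diag : ∀ {n} (i : Fin n) → δ i i ≈ 1#
  δ-diag zero    = refl
  δ-diag (suc i) = δ-diag i

  δ-off : ∀ {n} {i j : Fin n} → i ≢ j → δ i j ≈ 0#
  δ-off {i = zero}  {zero}  0≢0 = ⊥-elim (0≢0 ≡.refl)
  δ-off {i = zero}  {suc j} _   = refl
  δ-off {i = suc i} {zero}  _   = refl
  δ-off {i = suc i} {suc j} i≢j = δ-off (i≢j ∘ ≡.cong suc)

  δ-sym : ∀ {n} (i j : Fin n) → δ i j ≈ δ j i
  δ-sym zero    zero    = refl
  δ-sym zero    (suc j) = refl
  δ-sym (suc i) zero    = refl
  δ-sym (suc i) (suc j) = δ-sym i j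

  δ-punchIn : ∀ {n} (j : Fin (suc n)) (i c : Fin n) → δ (punchIn j i) (punchIn j c) ≡ δ i c
  δ-punchIn zero    i       c       = ≡.refl
  δ-punchIn (suc j) zero    zero    = ≡.refl
  δ-punchIn (suc j) zero    (suc c) = ≡.refl
  δ-punchIn (suc j) (suc i) zero    = ≡.refl
  δ-punchIn (suc j) (suc i) (suc c) = δ-punchIn j i c

  ∑-δˡ : ∀ {n} (i : Fin n) (f : Vector Carrier n) → ∑ (λ j → δ i j * f j) ≈ f i
  ∑-δˡ {suc n} zero f = begin
    ∑ (λ j → δ zero j * f j)                 ≈⟨ ∑-suc _ ⟩
    1# * f zero + ∑ (λ j → 0# * f (suc j))   ≈⟨ +-cong (*-identityˡ _) (∑-zero (λ j → zeroˡ _)) ⟩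
    f zero + 0#                               ≈⟨ +-identityʳ _ ⟩
    f zero                                    ∎
  ∑-δˡ {suc n} (suc i) f = begin
    ∑ (λ j → δ (suc i) j * f j)                 ≈⟨ ∑-suc _ ⟩
    0# * f zero + ∑ (λ j → δ i j * f (suc j))   ≈⟨ +-cong (zeroˡ _) (∑-δˡ i (f ∘ suc)) ⟩
    0# + f (suc i)                              ≈⟨ +-identityˡ _ ⟩
    f (suc i)                                   ∎

  ∑-δʳ : ∀ {n} (i : Fin n) (f : Vector Carrier n) → ∑ (λ j → f j * δ j i) ≈ f i
  ∑-δʳ i f = trans (∑-cong (λ j → trans (*-comm (f j) (δ j i)) (*-congʳ (δ-sym j i)))) (∑-δˡ i f)

  punchIn-ext : ∀ {n} (j : Fin (suc n)) {u v : Vector Carrier (suc n)} →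
                u j ≈ v j → (∀ c → u (punchIn j c) ≈ v (punchIn j c)) → ∀ d → u d ≈ v d
  punchIn-ext j {u} {v} uj≈vj u≈v d with j ≟ d
  ... | yes ≡.refl = uj≈vj
  ... | no j≢d     = ≡.subst (λ d → u d ≈ v d) (punchIn-punchOut j≢d) (u≈v (punchOut j≢d))

  row-split : ∀ {n} (j : Fin (suc n)) (u : Vector Carrier (suc n)) →
              ∀ d → u d ≈ insertAt (u ∘ punchIn j) j 0# d + u j * δ j d
  row-split j u = punchIn-ext j
    (sym (trans (+-cong (reflexive (insertAt-lookup (u ∘ punchIn j) j 0#)) (*-congˡ (δ-diag j)))
                (trans (+-identityˡ _) (*-identityʳ _))))
    (λ c → sym (trans (+-cong (reflexive (insertAt-punchIn (u ∘ punchIn j) j 0# c))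
                              (*-congˡ (δ-off (punchInᵢ≢i j c ∘ ≡.sym))))
                      (trans (+-congˡ (zeroʳ _)) (+-identityʳ _))))

  insertAt-cong : ∀ {n} (j : Fin (suc n)) a {u v : Vector Carrier n} →
                  (∀ c → u c ≈ v c) → ∀ d → insertAt u j a d ≈ insertAt v j a d
  insertAt-cong j a {u} {v} u≈v = punchIn-ext j
    (reflexive (≡.trans (insertAt-lookup u j a) (≡.sym (insertAt-lookup v j a))))
    (λ c → trans (reflexive (insertAt-punchIn u j a c)) (trans (u≈v c) (reflexive (≡.sym (insertAt-punchIn v j a c)))))

  insertAt-0-linear : ∀ {n} (j : Fin (suc n)) x (u : Vector Carrier n) y v →
    ∀ d → insertAt (λ c → x * u c + y * v c) j 0# d ≈ x * insertAt u j 0# d + y * insertAt v j 0# d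
  insertAt-0-linear j x u y v = punchIn-ext j
    (trans (reflexive (insertAt-lookup _ j 0#))
           (sym (trans (+-cong (*-congˡ (reflexive (insertAt-lookup u j 0#)))
                               (*-congˡ (reflexive (insertAt-lookup v j 0#))))
                       (trans (+-cong (zeroʳ x) (zeroʳ y)) (+-identityʳ 0#)))))
    (λ c → trans (reflexive (insertAt-punchIn _ j 0# c))
                 (sym (+-cong (*-congˡ (reflexive (insertAt-punchIn u j 0# c)))
                              (*-congˡ (reflexive (insertAt-punchIn v j 0# c))))))

  Matrix : ℕ → ℕ → Set c
  Matrix k m = Vector (Vector Carrier m) k

  infix 4 _≈ᴹ_
  _≈ᴹ_ : ∀ {k m} → Matrix k m → Matrix k m → Set ℓ
  A ≈ᴹ B = ∀ i j → A i j ≈ B i j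

  ≈ᴹ-refl : ∀ {k m} {A : Matrix k m} → A ≈ᴹ A
  ≈ᴹ-refl i j = refl

  ≈ᴹ-trans : ∀ {k m} {A B C : Matrix k m} → A ≈ᴹ B → B ≈ᴹ C → A ≈ᴹ C
  ≈ᴹ-trans A≈B B≈C i j = trans (A≈B i j) (B≈C i j)

  ≗⇒≈ᴹ : ∀ {k m} {A B : Matrix k m} → A ≗ B → A ≈ᴹ B
  ≗⇒≈ᴹ A≗B i j = reflexive (≡.cong (λ row → row j) (A≗B i))

  infixl 7 _*ᴹ_
  _*ᴹ_ : ∀ {k m p} → Matrix k m → Matrix m p → Matrix k p
  (A *ᴹ B) i j = ∑ (λ l → A i l * B l j)

  1ᴹ : ∀ {n} → Matrix n n
  1ᴹ = δ

  *ᴹ-cong : ∀ {k m p} {A A′ : Matrix k m} {B B′ : Matrix m p} →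
            A ≈ᴹ A′ → B ≈ᴹ B′ → A *ᴹ B ≈ᴹ A′ *ᴹ B′
  *ᴹ-cong A≈A′ B≈B′ i j = ∑-cong (λ l → *-cong (A≈A′ i l) (B≈B′ l j))

  *ᴹ-identityˡ : ∀ {k m} (A : Matrix k m) → 1ᴹ *ᴹ A ≈ᴹ A
  *ᴹ-identityˡ A i j = ∑-δˡ i (λ l → A l j)

  *ᴹ-identityʳ : ∀ {k m} (A : Matrix k m) → A *ᴹ 1ᴹ ≈ᴹ A
  *ᴹ-identityʳ A i j = ∑-δʳ j (A i)

  *ᴹ-assoc : ∀ {k m p q} (A : Matrix k m) (B : Matrix m p) (C : Matrix p q) → (A *ᴹ B) *ᴹ C ≈ᴹ A *ᴹ (B *ᴹ C)
  *ᴹ-assoc A B C i j = begin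
    ∑ (λ l → ∑ (λ r → A i r * B r l) * C l j)   ≈⟨ ∑-cong (λ l → *-distribʳ-∑ (C l j) (λ r → A i r * B r l)) ⟩
    ∑ (λ l → ∑ (λ r → (A i r * B r l) * C l j)) ≈⟨ ∑-swap (λ l r → (A i r * B r l) * C l j) ⟩
    ∑ (λ r → ∑ (λ l → (A i r * B r l) * C l j)) ≈⟨ ∑-cong (λ r → ∑-cong (λ l → *-assoc (A i r) (B r l) (C l j))) ⟩
    ∑ (λ r → ∑ (λ l → A i r * (B r l * C l j))) ≈⟨ ∑-cong (λ r → *-distribˡ-∑ (A i r) (λ l → B r l * C l j)) ⟨
    ∑ (λ r → A i r * ∑ (λ l → B r l * C l j))   ∎

  infixl 6 _[_]≔_
  _[_]≔_ : ∀ {k m} → Matrix k m → Fin k → Vector Carrier m → Matrix k m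
  A [ r ]≔ v = updateAt A r (const v)

  update-cong : ∀ {k m} {A B : Matrix k m} r {u v : Vector Carrier m} →
                A ≈ᴹ B → (∀ j → u j ≈ v j) → A [ r ]≔ u ≈ᴹ B [ r ]≔ v
  update-cong {suc k} zero    A≈B u≈v zero    = u≈v
  update-cong {suc k} zero    A≈B u≈v (suc i) = A≈B (suc i)
  update-cong {suc k} (suc r) A≈B u≈v zero    = A≈B zero
  update-cong {suc k} (suc r) A≈B u≈v (suc i) = update-cong r (A≈B ∘ suc) u≈v i

  map-update : ∀ {k m p} (g : Vector Carrier m → Vector Carrier p) (A : Matrix k m) r v →
               map g (A [ r ]≔ v) ≈ᴹ map g A [ r ]≔ g v
  map-update g A r v = ≗⇒≈ᴹ (map-updateAt {f = g} {g = const v} {h = const (g v)} (λ _ → ≡.refl) A r)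

  row-≡ : ∀ {m} {u v : Vector Carrier m} → u ≡ v → ∀ j → u j ≈ v j
  row-≡ u≡v j = reflexive (≡.cong (λ row → row j) u≡v)

  -- Alternating multilinear forms in the rows of a matrix

  record IsAlternatingMultilinear {k m} (D : Matrix k m → Carrier) : Set (c ⊔ ℓ) where
    field
      cong        : ∀ {A B} → A ≈ᴹ B → D A ≈ D B
      linear      : ∀ A r x u y v →
                    D (A [ r ]≔ (λ j → x * u j + y * v j)) ≈ x * D (A [ r ]≔ u) + y * D (A [ r ]≔ v)
      alternating : ∀ A {i k} → i ≢ k → (∀ j → A i j ≈ A k j) → D A ≈ 0#

    update-self : ∀ A r → D (A [ r ]≔ A r) ≈ D A
    update-self A r = cong (≗⇒≈ᴹ (updateAt-id-local r A ≡.refl))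

    additive : ∀ A r u v → D (A [ r ]≔ (λ j → u j + v j)) ≈ D (A [ r ]≔ u) + D (A [ r ]≔ v)
    additive A r u v = begin
      D (A [ r ]≔ (λ j → u j + v j))
        ≈⟨ cong (update-cong r ≈ᴹ-refl (λ j → sym (+-cong (*-identityˡ (u j)) (*-identityˡ (v j))))) ⟩
      D (A [ r ]≔ (λ j → 1# * u j + 1# * v j))
        ≈⟨ linear A r 1# u 1# v ⟩
      1# * D (A [ r ]≔ u) + 1# * D (A [ r ]≔ v)
        ≈⟨ +-cong (*-identityˡ _) (*-identityˡ _) ⟩
      D (A [ r ]≔ u) + D (A [ r ]≔ v) ∎

    zero-row : ∀ A r → D (A [ r ]≔ (λ _ → 0#)) ≈ 0#
    zero-row A r = x+x≈x⇒x≈0 _ (begin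
      D (A [ r ]≔ (λ _ → 0#)) + D (A [ r ]≔ (λ _ → 0#)) ≈⟨ additive A r (λ _ → 0#) (λ _ → 0#) ⟨
      D (A [ r ]≔ (λ _ → 0# + 0#))                      ≈⟨ cong (update-cong r ≈ᴹ-refl (λ _ → +-identityʳ 0#)) ⟩
      D (A [ r ]≔ (λ _ → 0#))                           ∎)

    linear-sum : ∀ {p} A r (t : Vector Carrier p) (V : Vector (Vector Carrier m) p) →
                 D (A [ r ]≔ (λ j → ∑ (λ l → t l * V l j))) ≈ ∑ (λ l → t l * D (A [ r ]≔ V l))
    linear-sum {zero}  A r t V = begin
      D (A [ r ]≔ (λ j → ∑ (λ l → t l * V l j))) ≈⟨ cong (update-cong r ≈ᴹ-refl (λ j → ∑-zero (λ ()))) ⟩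
      D (A [ r ]≔ (λ _ → 0#))                     ≈⟨ zero-row A r ⟩
      0#                                          ≈⟨ ∑-zero (λ ()) ⟨
      ∑ (λ l → t l * D (A [ r ]≔ V l))            ∎
    linear-sum {suc p} A r t V = begin
      D (A [ r ]≔ (λ j → ∑ (λ l → t l * V l j)))
        ≈⟨ cong (update-cong r ≈ᴹ-refl (λ j → trans (∑-suc _) (+-congˡ (sym (*-identityˡ (rest j)))))) ⟩
      D (A [ r ]≔ (λ j → t zero * V zero j + 1# * rest j))
        ≈⟨ linear A r (t zero) (V zero) 1# rest ⟩
      t zero * D (A [ r ]≔ V zero) + 1# * D (A [ r ]≔ rest)
        ≈⟨ +-congˡ (trans (*-identityˡ _) (linear-sum A r (t ∘ suc) (V ∘ suc))) ⟩
      t zero * D (A [ r ]≔ V zero) + ∑ (λ l → t (suc l) * D (A [ r ]≔ V (suc l)))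
        ≈⟨ ∑-suc _ ⟨
      ∑ (λ l → t l * D (A [ r ]≔ V l)) ∎
      where
      rest : Vector Carrier m
      rest j = ∑ (λ l → t (suc l) * V (suc l) j)

    add-multiple : ∀ A {r s} → r ≢ s → ∀ t → D (A [ r ]≔ (λ j → A r j + t * A s j)) ≈ D A
    add-multiple A {r} {s} r≢s t = begin
      D (A [ r ]≔ (λ j → A r j + t * A s j))
        ≈⟨ cong (update-cong r ≈ᴹ-refl (λ j → +-congʳ (sym (*-identityˡ (A r j))))) ⟩
      D (A [ r ]≔ (λ j → 1# * A r j + t * A s j))
        ≈⟨ linear A r 1# (A r) t (A s) ⟩
      1# * D (A [ r ]≔ A r) + t * D (A [ r ]≔ A s)
        ≈⟨ +-cong (trans (*-identityˡ _) (update-self A r)) (*-congˡ s-repeated) ⟩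
      D A + t * 0#
        ≈⟨ trans (+-congˡ (zeroʳ t)) (+-identityʳ _) ⟩
      D A ∎
      where
      s-repeated : D (A [ r ]≔ A s) ≈ 0#
      s-repeated = alternating (A [ r ]≔ A s) r≢s
        (row-≡ (≡.trans (updateAt-updates r A) (≡.sym (updateAt-minimal s r A (r≢s ∘ ≡.sym)))))

    swap-rows : ∀ A {i k} → i ≢ k → D (A [ i ]≔ A k [ k ]≔ A i) ≈ - D A
    swap-rows A {i} {k} i≢k = +-inverseʳ-unique (D A) (β v u) (begin
      D A + β v u                       ≈⟨ +-cong (sym β-u-v) (sym (+-identityʳ _)) ⟩
      β u v + (β v u + 0#)              ≈⟨ +-cong (trans (+-congʳ (β-diag u)) (+-identityˡ _)) (+-congˡ (β-diag v)) ⟨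
      (β u u + β u v) + (β v u + β v v) ≈⟨ +-cong (additive (A [ i ]≔ u) k u v) (additive (A [ i ]≔ v) k u v) ⟨
      β u w + β v w                     ≈⟨ β-additiveˡ ⟨
      β w w                             ≈⟨ β-diag w ⟩
      0#                                ∎)
      where
      u = A i
      v = A k
      w : Vector Carrier m
      w j = u j + v j
      -- β is bilinear and vanishes on the diagonal, hence antisymmetric.
      β : Vector Carrier m → Vector Carrier m → Carrier
      β x y = D (A [ i ]≔ x [ k ]≔ y)
      commute : ∀ x y → A [ i ]≔ x [ k ]≔ y ≈ᴹ A [ k ]≔ y [ i ]≔ x
      commute x y = ≗⇒≈ᴹ (updateAt-commutes k i (i≢k ∘ ≡.sym) A)
      β-additiveˡ : β w w ≈ β u w + β v w
      β-additiveˡ = trans (cong (commute w w))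
        (trans (additive (A [ k ]≔ w) i u v) (sym (+-cong (cong (commute u w)) (cong (commute v w)))))
      β-diag : ∀ x → β x x ≈ 0#
      β-diag x = alternating (A [ i ]≔ x [ k ]≔ x) i≢k
        (row-≡ (≡.trans (updateAt-minimal i k (A [ i ]≔ x) i≢k)
               (≡.trans (updateAt-updates i A) (≡.sym (updateAt-updates k (A [ i ]≔ x))))))
      β-u-v : β u v ≈ D A
      β-u-v = cong (≗⇒≈ᴹ (λ r → ≡.trans
        (updateAt-id-local k (A [ i ]≔ u) (≡.sym (updateAt-minimal k i A (i≢k ∘ ≡.sym))) r)
        (updateAt-id-local i A ≡.refl r)))

  shift-rows-invariant : ∀ {k m} (F : Matrix k m → Carrier) (e : Vector Carrier m) →
    (∀ {A B} → A ≈ᴹ B → F A ≈ F B) →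
    (∀ A r t → F (A [ r ]≔ (λ j → A r j + t * e j)) ≈ F A) →
    ∀ A (t : Vector Carrier k) → F (λ i j → A i j + t i * e j) ≈ F A
  shift-rows-invariant {zero}  F e F-cong F-shift A t = F-cong (λ ())
  shift-rows-invariant {suc k} F e F-cong F-shift A t = begin
    F (λ i j → A i j + t i * e j)
      ≈⟨ F-cong (λ { zero j → refl ; (suc i) j → refl }) ⟩
    F₀ (λ i j → A (suc i) j + t (suc i) * e j)
      ≈⟨ shift-rows-invariant F₀ e F₀-cong F₀-shift (tail A) (tail t) ⟩
    F₀ (tail A)
      ≈⟨ F-cong (λ { zero j → refl ; (suc i) j → refl }) ⟩
    F (A [ zero ]≔ row₀)
      ≈⟨ F-shift A zero (t zero) ⟩
    F A ∎
    where
    row₀ : Vector Carrier _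
    row₀ j = A zero j + t zero * e j
    F₀ : Matrix k _ → Carrier
    F₀ Q = F (row₀ ∷ Q)
    F₀-cong : ∀ {P Q} → P ≈ᴹ Q → F₀ P ≈ F₀ Q
    F₀-cong P≈Q = F-cong (λ { zero j → refl ; (suc i) j → P≈Q i j })
    F₀-shift : ∀ Q r s → F₀ (Q [ r ]≔ (λ j → Q r j + s * e j)) ≈ F₀ Q
    F₀-shift Q r s = trans (F-cong (λ { zero j → refl ; (suc i) j → refl })) (F-shift (row₀ ∷ Q) (suc r) s)

  add-multiples-of-row₀ : ∀ {k m} {D : Matrix (suc k) m → Carrier} → IsAlternatingMultilinear D →
    ∀ A (t : Vector Carrier k) → D (A zero ∷ λ i j → A (suc i) j + t i * A zero j) ≈ D A
  add-multiples-of-row₀ {D = D} isD A t =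
    trans (shift-rows-invariant (λ Q → D (A zero ∷ Q)) (A zero) cong′ shift (tail A) t)
          (cong (λ { zero j → refl ; (suc i) j → refl }))
    where
    open IsAlternatingMultilinear isD
    cong′ : ∀ {P Q} → P ≈ᴹ Q → D (A zero ∷ P) ≈ D (A zero ∷ Q)
    cong′ P≈Q = cong (λ { zero j → refl ; (suc i) j → P≈Q i j })
    shift : ∀ Q r s → D (A zero ∷ Q [ r ]≔ (λ j → Q r j + s * A zero j)) ≈ D (A zero ∷ Q)
    shift Q r s = trans (cong (λ { zero j → refl ; (suc i) j → refl }))
                        (add-multiple (A zero ∷ Q) {suc r} {zero} (λ ()) s)

  -- Determinants

  sgn : ∀ {n} → Fin n → Carrier
  sgn zero    = 1#
  sgn (suc j) = - sgn j

  minor : ∀ {n} → Fin (suc n) → Matrix (suc n) (suc n) → Matrix n n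
  minor j A i c = A (suc i) (punchIn j c)

  det : ∀ {n} → Matrix n n → Carrier
  det {zero}  A = 1#
  det {suc n} A = ∑ (λ j → sgn j * (A zero j * det (minor j A)))

  det-cong : ∀ {n} {A B : Matrix n n} → A ≈ᴹ B → det A ≈ det B
  det-cong {zero}  A≈B = refl
  det-cong {suc n} A≈B = ∑-cong (λ j →
    *-congˡ (*-cong (A≈B zero j) (det-cong (λ i c → A≈B (suc i) (punchIn j c)))))

  minor-update : ∀ {n} j (A : Matrix (suc n) (suc n)) r v →
                 minor j (A [ suc r ]≔ v) ≈ᴹ minor j A [ r ]≔ (v ∘ punchIn j)
  minor-update j A r v = map-update (_∘ punchIn j) (tail A) r v

  det-linear : ∀ {n} (A : Matrix n n) r x u y v →
               det (A [ r ]≔ (λ j → x * u j + y * v j)) ≈ x * det (A [ r ]≔ u) + y * det (A [ r ]≔ v)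
  det-linear {suc n} A zero x u y v =
    trans (∑-cong (λ j → term-linear (sgn j) (u j) (v j) (det (minor j A))))
          (∑-linear x y (λ j → sgn j * (u j * det (minor j A))) (λ j → sgn j * (v j * det (minor j A))))
    where
    term-linear : ∀ s a b d → s * ((x * a + y * b) * d) ≈ x * (s * (a * d)) + y * (s * (b * d))
    term-linear s a b d = begin
      s * ((x * a + y * b) * d)             ≈⟨ *-congˡ (distribʳ d (x * a) (y * b)) ⟩
      s * ((x * a) * d + (y * b) * d)       ≈⟨ distribˡ s _ _ ⟩
      s * ((x * a) * d) + s * ((y * b) * d) ≈⟨ +-cong (*-congˡ (*-assoc x a d)) (*-congˡ (*-assoc y b d)) ⟩
      s * (x * (a * d)) + s * (y * (b * d)) ≈⟨ +-cong (x∙yz≈y∙xz s x _) (x∙yz≈y∙xz s y _) ⟩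
      x * (s * (a * d)) + y * (s * (b * d)) ∎
  det-linear {suc n} A (suc r) x u y v = begin
    det (A [ suc r ]≔ w)
      ≈⟨ ∑-cong (λ j → *-congˡ (*-congˡ (trans (det-cong (minor-update j A r w))
                                                (det-linear (minor j A) r x (u ∘ punchIn j) y (v ∘ punchIn j))))) ⟩
    ∑ (λ j → sgn j * (A zero j * (x * d u j + y * d v j)))
      ≈⟨ ∑-cong (λ j → term-linear (sgn j) (A zero j) (d u j) (d v j)) ⟩
    ∑ (λ j → x * (sgn j * (A zero j * d u j)) + y * (sgn j * (A zero j * d v j)))
      ≈⟨ ∑-linear x y (expansion u) (expansion v) ⟩
    x * ∑ (expansion u) + y * ∑ (expansion v)
      ≈⟨ +-cong (*-congˡ (expansion≈det u)) (*-congˡ (expansion≈det v)) ⟩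
    x * det (A [ suc r ]≔ u) + y * det (A [ suc r ]≔ v)
      ∎
    where
    w : Vector Carrier (suc n)
    w j = x * u j + y * v j
    d : Vector Carrier (suc n) → Fin (suc n) → Carrier
    d z j = det (minor j A [ r ]≔ (z ∘ punchIn j))
    expansion : Vector Carrier (suc n) → Vector Carrier (suc n)
    expansion z j = sgn j * (A zero j * d z j)
    expansion≈det : ∀ z → ∑ (expansion z) ≈ det (A [ suc r ]≔ z)
    expansion≈det z = ∑-cong (λ j → *-congˡ (*-congˡ (sym (det-cong (minor-update j A r z)))))
    term-linear : ∀ s a p q → s * (a * (x * p + y * q)) ≈ x * (s * (a * p)) + y * (s * (a * q))
    term-linear s a p q = begin
      s * (a * (x * p + y * q))             ≈⟨ *-congˡ (distribˡ a (x * p) (y * q)) ⟩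
      s * (a * (x * p) + a * (y * q))       ≈⟨ distribˡ s _ _ ⟩
      s * (a * (x * p)) + s * (a * (y * q)) ≈⟨ +-cong (*-congˡ (x∙yz≈y∙xz a x p)) (*-congˡ (x∙yz≈y∙xz a y q)) ⟩
      s * (x * (a * p)) + s * (y * (a * q)) ≈⟨ +-cong (x∙yz≈y∙xz s x _) (x∙yz≈y∙xz s y _) ⟩
      x * (s * (a * p)) + y * (s * (a * q)) ∎

  laplace² : ∀ {k} → Vector Carrier (suc (suc k)) → ((Fin k → Fin (suc (suc k))) → Carrier) →
             Fin (suc (suc k)) → Fin (suc k) → Carrier
  laplace² a Φ j c = (sgn j * sgn c) * ((a j * a (punchIn j c)) * Φ (punchIn j ∘ punchIn c))

  -- The terms with j = 0 cancel those with c = 0 in pairs (same entries and minor, opposite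
  -- signs); the remaining terms form the same double sum for a ∘ suc.
  ∑∑-laplace²-cancels : ∀ k (a : Vector Carrier (suc (suc k))) (Φ : (Fin k → Fin (suc (suc k))) → Carrier) →
                        (∀ {κ κ′} → κ ≗ κ′ → Φ κ ≈ Φ κ′) → ∑ (λ j → ∑ (laplace² a Φ j)) ≈ 0#
  ∑∑-laplace²-cancels k a Φ Φ-cong = begin
    ∑ (λ j → ∑ (T j))
      ≈⟨ trans (∑-suc _) (+-congˡ (∑-cong (λ j → ∑-suc (T (suc j))))) ⟩
    ∑ (T zero) + ∑ (λ j → T (suc j) zero + ∑ (λ c → T (suc j) (suc c)))
      ≈⟨ +-congˡ (∑-+ (λ j → T (suc j) zero) (λ j → ∑ (λ c → T (suc j) (suc c)))) ⟩
    ∑ (T zero) + (∑ (λ j → T (suc j) zero) + ∑ (λ j → ∑ (λ c → T (suc j) (suc c))))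
      ≈⟨ +-assoc _ _ _ ⟨
    (∑ (T zero) + ∑ (λ j → T (suc j) zero)) + ∑ (λ j → ∑ (λ c → T (suc j) (suc c)))
      ≈⟨ +-cong (trans (sym (∑-+ (T zero) (λ j → T (suc j) zero))) (∑-zero (λ c → opposite (sgn c) _ _ _)))
                (interior-cancels k a Φ Φ-cong) ⟩
    0# + 0#
      ≈⟨ +-identityʳ 0# ⟩
    0# ∎
    where
    T = laplace² a Φ
    opposite : ∀ s p q X → (1# * s) * ((p * q) * X) + (- s * 1#) * ((q * p) * X) ≈ 0#
    opposite s p q X = begin
      (1# * s) * ((p * q) * X) + (- s * 1#) * ((q * p) * X)
        ≈⟨ +-cong (*-congʳ (*-identityˡ s)) (*-cong (*-identityʳ (- s)) (*-congʳ (*-comm q p))) ⟩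
      s * ((p * q) * X) + - s * ((p * q) * X)               ≈⟨ distribʳ _ s (- s) ⟨
      (s + - s) * ((p * q) * X)                              ≈⟨ *-congʳ (-‿inverseʳ s) ⟩
      0# * ((p * q) * X)                                     ≈⟨ zeroˡ _ ⟩
      0#                                                     ∎
    interior-cancels : ∀ k (a : Vector Carrier (suc (suc k))) Φ → (∀ {κ κ′} → κ ≗ κ′ → Φ κ ≈ Φ κ′) →
                       ∑ (λ j → ∑ (λ c → laplace² a Φ (suc j) (suc c))) ≈ 0#
    interior-cancels zero    a Φ Φ-cong = ∑-zero (λ j → ∑-zero (λ ()))
    interior-cancels (suc k) a Φ Φ-cong = trans
      (∑-cong (λ j → ∑-cong (λ c → *-cong (-x*-y≈x*y (sgn j) (sgn c))
                                          (*-congˡ (Φ-cong (λ { zero → ≡.refl ; (suc d) → ≡.refl }))))))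
      (∑∑-laplace²-cancels k (a ∘ suc) (λ κ → Φ (zero ∷ suc ∘ κ))
        (λ κ≗κ′ → Φ-cong (λ { zero → ≡.refl ; (suc d) → ≡.cong suc (κ≗κ′ d) })))

  det-rows₀₁ : ∀ {n} (A : Matrix (suc (suc n)) (suc (suc n))) → (∀ j → A zero j ≈ A (suc zero) j) → det A ≈ 0#
  det-rows₀₁ {n} A row₀≈row₁ = trans (∑-cong expand) (∑∑-laplace²-cancels n (A zero) Φ Φ-cong)
    where
    Φ : (Fin n → Fin (suc (suc n))) → Carrier
    Φ κ = det (λ i d → A (suc (suc i)) (κ d))
    Φ-cong : ∀ {κ κ′} → κ ≗ κ′ → Φ κ ≈ Φ κ′
    Φ-cong κ≗κ′ = det-cong (λ i d → reflexive (≡.cong (A (suc (suc i))) (κ≗κ′ d)))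
    regroup : ∀ s a t b φ → s * (a * (t * (b * φ))) ≈ (s * t) * ((a * b) * φ)
    regroup s a t b φ = begin
      s * (a * (t * (b * φ))) ≈⟨ *-congˡ (x∙yz≈y∙xz a t _) ⟩
      s * (t * (a * (b * φ))) ≈⟨ *-congˡ (*-congˡ (*-assoc a b φ)) ⟨
      s * (t * ((a * b) * φ)) ≈⟨ *-assoc s t _ ⟨
      (s * t) * ((a * b) * φ) ∎
    expand : ∀ j → sgn j * (A zero j * det (minor j A)) ≈ ∑ (laplace² (A zero) Φ j)
    expand j = begin
      sgn j * (A zero j * ∑ (λ c → sgn c * (A (suc zero) (punchIn j c) * Φ (punchIn j ∘ punchIn c))))
        ≈⟨ *-congˡ (*-distribˡ-∑ _ _) ⟩
      sgn j * ∑ (λ c → A zero j * (sgn c * (A (suc zero) (punchIn j c) * Φ (punchIn j ∘ punchIn c))))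
        ≈⟨ *-distribˡ-∑ _ _ ⟩
      ∑ (λ c → sgn j * (A zero j * (sgn c * (A (suc zero) (punchIn j c) * Φ (punchIn j ∘ punchIn c)))))
        ≈⟨ ∑-cong (λ c → trans (regroup _ _ _ _ _) (*-congˡ (*-congʳ (*-congˡ (sym (row₀≈row₁ _)))))) ⟩
      ∑ (laplace² (A zero) Φ j) ∎

  det-swap-lower-rows : ∀ {n} → IsAlternatingMultilinear (det {n}) →
    ∀ (A : Matrix (suc n) (suc n)) {a b} → a ≢ b → det (A [ suc a ]≔ A (suc b) [ suc b ]≔ A (suc a)) ≈ - det A
  det-swap-lower-rows isDet A {a} {b} a≢b = begin
    ∑ (λ j → sgn j * (A zero j * det (minor j (A [ suc a ]≔ A (suc b) [ suc b ]≔ A (suc a)))))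
      ≈⟨ ∑-cong (λ j → *-congˡ (*-congˡ (trans (det-cong (minor-swap j)) (swap-rows (minor j A) a≢b)))) ⟩
    ∑ (λ j → sgn j * (A zero j * - det (minor j A)))
      ≈⟨ ∑-cong (λ j → x*[y*-z]≈-[x*[y*z]] _ _ _) ⟩
    ∑ (λ j → - (sgn j * (A zero j * det (minor j A))))
      ≈⟨ -‿∑ _ ⟨
    - det A ∎
    where
    open IsAlternatingMultilinear isDet using (swap-rows)
    minor-swap : ∀ j → minor j (A [ suc a ]≔ A (suc b) [ suc b ]≔ A (suc a)) ≈ᴹ
                       minor j A [ a ]≔ minor j A b [ b ]≔ minor j A a
    minor-swap j = ≈ᴹ-trans (minor-update j (A [ suc a ]≔ A (suc b)) b (A (suc a)))
                            (update-cong b (minor-update j A a (A (suc b))) (λ _ → refl))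

  det-alternating : ∀ {n} (A : Matrix n n) {i k} → i ≢ k → (∀ j → A i j ≈ A k j) → det A ≈ 0#
  det-alternating-row₀ : ∀ {n} (A : Matrix (suc n) (suc n)) k → (∀ j → A zero j ≈ A (suc k) j) → det A ≈ 0#
  det-isAlternatingMultilinear : ∀ {n} → IsAlternatingMultilinear (det {n})

  det-alternating {suc n} A {zero}  {zero}  0≢0 _  = ⊥-elim (0≢0 ≡.refl)
  det-alternating {suc n} A {zero}  {suc k} _   eq = det-alternating-row₀ A k eq
  det-alternating {suc n} A {suc i} {zero}  _   eq = det-alternating-row₀ A i (λ j → sym (eq j))
  det-alternating {suc n} A {suc i} {suc k} i≢k eq = ∑-zero (λ j →
    trans (*-congˡ (trans (*-congˡ (det-alternating (minor j A) (i≢k ∘ ≡.cong suc) (eq ∘ punchIn j))) (zeroʳ _)))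
          (zeroʳ _))

  det-alternating-row₀ {suc n} A zero    row₀≈row₁ = det-rows₀₁ A row₀≈row₁
  det-alternating-row₀ {suc n} A (suc k) row₀≈row = begin
    det A        ≈⟨ -‿involutive _ ⟨
    - - det A    ≈⟨ -‿cong (det-swap-lower-rows det-isAlternatingMultilinear A {zero} {suc k} (λ ())) ⟨
    - det B      ≈⟨ -‿cong (det-rows₀₁ B row₀≈row) ⟩
    - 0#         ≈⟨ -0#≈0# ⟩
    0#           ∎
    where
    B : Matrix (suc (suc n)) (suc (suc n))
    B = A [ suc zero ]≔ A (suc (suc k)) [ suc (suc k) ]≔ A (suc zero)

  det-isAlternatingMultilinear = record
    { cong = det-cong ; linear = det-linear ; alternating = det-alternating }

  bordered : ∀ {n} → Fin (suc n) → Matrix n n → Matrix (suc n) (suc n)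
  bordered j M = δ j ∷ map (λ row → insertAt row j 0#) M

  bordered-isAlternatingMultilinear : ∀ {n} {D : Matrix (suc n) (suc n) → Carrier} →
    IsAlternatingMultilinear D → ∀ j → IsAlternatingMultilinear (D ∘ bordered j)
  bordered-isAlternatingMultilinear {D = D} isD j = record
    { cong        = λ M≈N → cong (bordered-cong M≈N)
    ; linear      = linear′
    ; alternating = λ M i≢k Mi≈Mk →
                      alternating (bordered j M) (i≢k ∘ suc-injective) (insertAt-cong j 0# Mi≈Mk)
    }
    where
    open IsAlternatingMultilinear isD
    bordered-cong : ∀ {M N} → M ≈ᴹ N → bordered j M ≈ᴹ bordered j N
    bordered-cong M≈N zero    = λ _ → refl
    bordered-cong M≈N (suc i) = insertAt-cong j 0# (M≈N i)
    bordered-update : ∀ M r w → bordered j (M [ r ]≔ w) ≈ᴹ bordered j M [ suc r ]≔ insertAt w j 0#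
    bordered-update M r w zero    = λ _ → refl
    bordered-update M r w (suc i) = map-update (λ row → insertAt row j 0#) M r w i
    linear′ : ∀ M r x u y v → D (bordered j (M [ r ]≔ (λ c → x * u c + y * v c))) ≈
                              x * D (bordered j (M [ r ]≔ u)) + y * D (bordered j (M [ r ]≔ v))
    linear′ M r x u y v = begin
      D (bordered j (M [ r ]≔ (λ c → x * u c + y * v c)))
        ≈⟨ cong (≈ᴹ-trans (bordered-update M r _) (update-cong (suc r) ≈ᴹ-refl (insertAt-0-linear j x u y v))) ⟩
      D (bordered j M [ suc r ]≔ (λ d → x * insertAt u j 0# d + y * insertAt v j 0# d))
        ≈⟨ linear (bordered j M) (suc r) x (insertAt u j 0#) y (insertAt v j 0#) ⟩
      x * D (bordered j M [ suc r ]≔ insertAt u j 0#) + y * D (bordered j M [ suc r ]≔ insertAt v j 0#)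
        ≈⟨ +-cong (*-congˡ (cong (bordered-update M r u))) (*-congˡ (cong (bordered-update M r v))) ⟨
      x * D (bordered j (M [ r ]≔ u)) + y * D (bordered j (M [ r ]≔ v)) ∎

  bring-to-front : ∀ {n} → Fin (suc n) → Fin (suc n) → Fin (suc n)
  bring-to-front j zero    = j
  bring-to-front j (suc i) = punchIn j i

  bring-to-front-sign : ∀ {n} {D : Matrix (suc n) (suc n) → Carrier} → IsAlternatingMultilinear D →
                        ∀ j → D (1ᴹ ∘ bring-to-front j) ≈ sgn j * D 1ᴹ
  bring-to-front-sign isD zero = trans (cong (λ { zero d → refl ; (suc i) d → refl })) (sym (*-identityˡ _))
    where open IsAlternatingMultilinear isD
  bring-to-front-sign {zero} isD (suc ())
  bring-to-front-sign {suc n} {D} isD (suc j) = begin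
    D (1ᴹ ∘ bring-to-front (suc j))
      ≈⟨ cong (λ { zero zero → refl ; zero (suc d) → refl ; (suc zero) d → refl
                 ; (suc (suc i)) zero → refl ; (suc (suc i)) (suc d) → refl }) ⟩
    D (B [ zero ]≔ B (suc zero) [ suc zero ]≔ B zero)
      ≈⟨ swap-rows B {zero} {suc zero} (λ ()) ⟩
    - D B
      ≈⟨ -‿cong (bring-to-front-sign (bordered-isAlternatingMultilinear isD zero) j) ⟩
    - (sgn j * D (bordered zero 1ᴹ))
      ≈⟨ -‿cong (*-congˡ (cong (λ { zero d → refl ; (suc i) zero → refl ; (suc i) (suc d) → refl }))) ⟩
    - (sgn j * D 1ᴹ)
      ≈⟨ -‿distribˡ-* _ _ ⟩
    - sgn j * D 1ᴹ ∎
    where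
    open IsAlternatingMultilinear isD
    B : Matrix (suc (suc n)) (suc (suc n))
    B = bordered zero (1ᴹ ∘ bring-to-front j)

  bordered-1ᴹ : ∀ {n} (j : Fin (suc n)) → bordered j 1ᴹ ≈ᴹ 1ᴹ ∘ bring-to-front j
  bordered-1ᴹ j zero    = λ _ → refl
  bordered-1ᴹ j (suc i) = punchIn-ext j
    (trans (reflexive (insertAt-lookup (δ i) j 0#)) (sym (δ-off (punchInᵢ≢i j i))))
    (λ c → reflexive (≡.trans (insertAt-punchIn (δ i) j 0# c) (≡.sym (δ-punchIn j i c))))

  -- Expand row 0 of A in the standard basis.  For the basis row δ j, clearing column j in
  -- the other rows leaves the alternating form D ∘ bordered j at minor j A, and induction
  -- applies.
  det-unique : ∀ {n} {D : Matrix n n → Carrier} → IsAlternatingMultilinear D → ∀ A → D A ≈ det A * D 1ᴹ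
  det-unique {zero} isD A = trans (IsAlternatingMultilinear.cong isD (λ ())) (sym (*-identityˡ _))
  det-unique {suc n} {D} isD A = begin
    D A
      ≈⟨ cong (λ { zero d → sym (∑-δʳ d (A zero)) ; (suc i) d → refl }) ⟩
    D (A [ zero ]≔ (λ d → ∑ (λ j → A zero j * δ j d)))
      ≈⟨ linear-sum A zero (A zero) δ ⟩
    ∑ (λ j → A zero j * D (A [ zero ]≔ δ j))
      ≈⟨ ∑-cong (λ j → *-congˡ (basis-row j)) ⟩
    ∑ (λ j → A zero j * (det (minor j A) * (sgn j * D 1ᴹ)))
      ≈⟨ ∑-cong (λ j → pull-right _ _ _ _) ⟩
    ∑ (λ j → sgn j * (A zero j * det (minor j A)) * D 1ᴹ)
      ≈⟨ *-distribʳ-∑ _ _ ⟨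
    det A * D 1ᴹ ∎
    where
    open IsAlternatingMultilinear isD
    pull-right : ∀ a d s e → a * (d * (s * e)) ≈ (s * (a * d)) * e
    pull-right a d s e = trans (sym (*-assoc a d (s * e))) (x∙yz≈yx∙z (a * d) s e)
    basis-row : ∀ j → D (A [ zero ]≔ δ j) ≈ det (minor j A) * (sgn j * D 1ᴹ)
    basis-row j = begin
      D (A [ zero ]≔ δ j)
        ≈⟨ cong (λ { zero d → refl ; (suc i) d → row-split j (A (suc i)) d }) ⟩
      D (δ j ∷ λ i d → insertAt (minor j A i) j 0# d + A (suc i) j * δ j d)
        ≈⟨ add-multiples-of-row₀ isD (bordered j (minor j A)) (λ i → A (suc i) j) ⟩
      D (bordered j (minor j A))
        ≈⟨ det-unique (bordered-isAlternatingMultilinear isD j) (minor j A) ⟩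
      det (minor j A) * D (bordered j 1ᴹ)
        ≈⟨ *-congˡ (trans (cong (bordered-1ᴹ j)) (bring-to-front-sign isD j)) ⟩
      det (minor j A) * (sgn j * D 1ᴹ) ∎

  det-1ᴹ : ∀ {n} → det {n} 1ᴹ ≈ 1#
  det-1ᴹ {zero}  = refl
  det-1ᴹ {suc n} = begin
    det {suc n} 1ᴹ
      ≈⟨ ∑-suc _ ⟩
    1# * (1# * det {n} 1ᴹ) + ∑ (λ j → sgn (suc j) * (0# * _))
      ≈⟨ +-cong (trans (*-identityˡ _) (*-identityˡ _)) (∑-zero (λ j → trans (*-congˡ (zeroˡ _)) (zeroʳ _))) ⟩
    det {n} 1ᴹ + 0#
      ≈⟨ trans (+-identityʳ _) (det-1ᴹ {n}) ⟩
    1# ∎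

  *ᴹ-isAlternatingMultilinear : ∀ {k m p} {D : Matrix k p → Carrier} → IsAlternatingMultilinear D →
    (B : Matrix m p) → IsAlternatingMultilinear (λ A → D (A *ᴹ B))
  *ᴹ-isAlternatingMultilinear {D = D} isD B = record
    { cong        = λ A≈A′ → cong (*ᴹ-cong A≈A′ ≈ᴹ-refl)
    ; linear      = linear′
    ; alternating = λ A i≢k Ai≈Ak →
                      alternating (A *ᴹ B) i≢k (λ j → ∑-cong (λ l → *-congʳ (Ai≈Ak l)))
    }
    where
    open IsAlternatingMultilinear isD
    _*B : Vector Carrier _ → Vector Carrier _
    (u *B) j = ∑ (λ l → u l * B l j)
    update-*ᴹ : ∀ A r u → (A [ r ]≔ u) *ᴹ B ≈ᴹ (A *ᴹ B) [ r ]≔ (u *B)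
    update-*ᴹ A r u = map-update _*B A r u
    linear′ : ∀ A r x u y v → D ((A [ r ]≔ (λ j → x * u j + y * v j)) *ᴹ B) ≈
                              x * D ((A [ r ]≔ u) *ᴹ B) + y * D ((A [ r ]≔ v) *ᴹ B)
    linear′ A r x u y v = begin
      D ((A [ r ]≔ (λ j → x * u j + y * v j)) *ᴹ B)
        ≈⟨ cong (≈ᴹ-trans (update-*ᴹ A r _) (update-cong r ≈ᴹ-refl combination)) ⟩
      D ((A *ᴹ B) [ r ]≔ (λ j → x * (u *B) j + y * (v *B) j))
        ≈⟨ linear (A *ᴹ B) r x (u *B) y (v *B) ⟩
      x * D ((A *ᴹ B) [ r ]≔ (u *B)) + y * D ((A *ᴹ B) [ r ]≔ (v *B))
        ≈⟨ +-cong (*-congˡ (cong (update-*ᴹ A r u))) (*-congˡ (cong (update-*ᴹ A r v))) ⟨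
      x * D ((A [ r ]≔ u) *ᴹ B) + y * D ((A [ r ]≔ v) *ᴹ B) ∎
      where
      combination : ∀ j → ∑ (λ l → (x * u l + y * v l) * B l j) ≈ x * (u *B) j + y * (v *B) j
      combination j = trans (∑-cong (λ l → trans (distribʳ _ _ _) (+-cong (*-assoc x _ _) (*-assoc y _ _))))
                            (∑-linear x y (λ l → u l * B l j) (λ l → v l * B l j))

  det-*ᴹ : ∀ {n} (A B : Matrix n n) → det (A *ᴹ B) ≈ det A * det B
  det-*ᴹ A B = trans (det-unique (*ᴹ-isAlternatingMultilinear det-isAlternatingMultilinear B) A)
                     (*-congˡ (det-cong (*ᴹ-identityˡ B)))

  adjugate : ∀ {n} → Matrix n n → Matrix n n
  adjugate A j k = det (A [ k ]≔ δ j)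

  *ᴹ-adjugate : ∀ {n} (A : Matrix n n) → ∀ i k → (A *ᴹ adjugate A) i k ≈ det A * δ i k
  *ᴹ-adjugate A i k = begin
    ∑ (λ j → A i j * det (A [ k ]≔ δ j))            ≈⟨ linear-sum A k (A i) δ ⟨
    det (A [ k ]≔ (λ d → ∑ (λ j → A i j * δ j d)))  ≈⟨ det-cong (update-cong k ≈ᴹ-refl (λ d → ∑-δʳ d (A i))) ⟩
    det (A [ k ]≔ A i)                              ≈⟨ row-i-at-k (i ≟ k) ⟩
    det A * δ i k                                   ∎
    where
    open IsAlternatingMultilinear det-isAlternatingMultilinear
    row-i-at-k : Dec (i ≡ k) → det (A [ k ]≔ A i) ≈ det A * δ i k
    row-i-at-k (yes ≡.refl) = trans (update-self A i) (sym (trans (*-congˡ (δ-diag i)) (*-identityʳ _)))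
    row-i-at-k (no i≢k)     = trans
      (alternating (A [ k ]≔ A i) i≢k
        (row-≡ (≡.trans (updateAt-minimal i k A i≢k) (≡.sym (updateAt-updates k A)))))
      (sym (trans (*-congˡ (δ-off i≢k)) (zeroʳ _)))

  left-inverse⇒right-inverse : ∀ {n} (A C : Matrix n n) → C *ᴹ A ≈ᴹ 1ᴹ → A *ᴹ C ≈ᴹ 1ᴹ
  left-inverse⇒right-inverse {n} A C CA≈1 = ≈ᴹ-trans (*ᴹ-cong {A = A} ≈ᴹ-refl C≈Y) AY≈1
    where
    detC*detA≈1 : det C * det A ≈ 1#
    detC*detA≈1 = trans (sym (det-*ᴹ C A)) (trans (det-cong CA≈1) (det-1ᴹ {n}))
    Y : Matrix n n
    Y j k = det C * adjugate A j k
    AY≈1 : A *ᴹ Y ≈ᴹ 1ᴹ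
    AY≈1 i k = begin
      ∑ (λ j → A i j * (det C * adjugate A j k)) ≈⟨ ∑-cong (λ j → x∙yz≈y∙xz _ _ _) ⟩
      ∑ (λ j → det C * (A i j * adjugate A j k)) ≈⟨ *-distribˡ-∑ _ _ ⟨
      det C * (A *ᴹ adjugate A) i k              ≈⟨ *-congˡ (*ᴹ-adjugate A i k) ⟩
      det C * (det A * δ i k)                    ≈⟨ *-assoc _ _ _ ⟨
      (det C * det A) * δ i k                    ≈⟨ trans (*-congʳ detC*detA≈1) (*-identityˡ _) ⟩
      δ i k                                      ∎
    C≈Y : C ≈ᴹ Y
    C≈Y i k = begin
      C i k                  ≈⟨ *ᴹ-identityʳ C i k ⟨
      (C *ᴹ 1ᴹ) i k          ≈⟨ *ᴹ-cong {A = C} ≈ᴹ-refl AY≈1 i k ⟨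
      (C *ᴹ (A *ᴹ Y)) i k    ≈⟨ *ᴹ-assoc C A Y i k ⟨
      ((C *ᴹ A) *ᴹ Y) i k    ≈⟨ *ᴹ-cong {B = Y} CA≈1 ≈ᴹ-refl i k ⟩
      (1ᴹ *ᴹ Y) i k          ≈⟨ *ᴹ-identityˡ Y i k ⟩
      Y i k                  ∎

-- Generators of GL

open import Defs

module _ {c ℓ : Level} (L : Field c ℓ) where
  open Field L hiding (zero)
  open Determinants commutativeRing
    using (∑; ∑-suc; ∑-zero; ∑-cong; ∑-swap; ∑-permute; *-distribˡ-∑; *-distribʳ-∑;
           δ; δ-diag; δ-off; ∑-δʳ; _≈ᴹ_; _*ᴹ_; 1ᴹ; left-inverse⇒right-inverse)
  open import Relation.Binary.Reasoning.Setoid setoid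

  Σ≈∑ : ∀ k (f : Fin k → Carrier) → Σ[_] L k f ≈ ∑ f
  Σ≈∑ zero    f = sym (∑-zero (λ ()))
  Σ≈∑ (suc k) f = trans (+-congˡ (Σ≈∑ k (f ∘ suc))) (sym (∑-suc f))

  identityMatrix⇒≈1ᴹ : ∀ {k} {M : Matrix L k k} → IdentityMatrix L M → M ≈ᴹ 1ᴹ
  identityMatrix⇒≈1ᴹ M-id i j with i ≟ j
  ... | yes ≡.refl = trans (proj₁ (M-id i i) ≡.refl) (sym (δ-diag i))
  ... | no i≢j     = trans (proj₂ (M-id i j) i≢j) (sym (δ-off i≢j))

  ≈1ᴹ⇒identityMatrix : ∀ {k} {M : Matrix L k k} → M ≈ᴹ 1ᴹ → IdentityMatrix L M
  ≈1ᴹ⇒identityMatrix M≈1 i j = (λ { ≡.refl → trans (M≈1 i i) (δ-diag i) }) , (λ i≢j → trans (M≈1 i j) (δ-off i≢j))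

  HasLeftInverse : ∀ {m n} → Matrix L m n → Set (c ⊔ ℓ)
  HasLeftInverse {m} {n} A = Σ (Matrix L n m) λ B → B *ᴹ A ≈ᴹ 1ᴹ

  nonsingular⇔hasLeftInverse : ∀ {m n} → m ≡ n → (A : Matrix L m n) → Nonsingular L A ⇔ HasLeftInverse A
  nonsingular⇔hasLeftInverse ≡.refl A = mk⇔
    (λ (B , _ , BA-id) → B , λ i j → trans (sym (Σ≈∑ _ _)) (identityMatrix⇒≈1ᴹ BA-id i j))
    (λ (B , BA≈1) → B , from (left-inverse⇒right-inverse A B BA≈1) , from BA≈1)
    where
    from : ∀ {P Q} → P *ᴹ Q ≈ᴹ 1ᴹ → IdentityMatrix L (_·ᴹ_ L P Q)
    from PQ≈1 = ≈1ᴹ⇒identityMatrix (λ i j → trans (Σ≈∑ _ _) (PQ≈1 i j))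

  hasLeftInverse-permuteRows : ∀ {m n} {A A′ : Matrix L m n} (π : Permutation′ m) →
    (∀ i h → A′ i h ≈ A (π ⟨$⟩ʳ i) h) → HasLeftInverse A → HasLeftInverse A′
  hasLeftInverse-permuteRows {A = A} {A′} π A′≈Aπ (B , BA≈1) = (λ g i → B g (π ⟨$⟩ʳ i)) , λ g h → begin
    ∑ (λ i → B g (π ⟨$⟩ʳ i) * A′ i h)           ≈⟨ ∑-cong (λ i → *-congˡ (A′≈Aπ i h)) ⟩
    ∑ (λ i → B g (π ⟨$⟩ʳ i) * A (π ⟨$⟩ʳ i) h)   ≈⟨ ∑-permute (λ i → B g i * A i h) π ⟨
    ∑ (λ i → B g i * A i h)                     ≈⟨ BA≈1 g h ⟩
    δ g h                                       ∎

  generator⇔hasLeftInverse : ∀ {m n} (ν : Fin m → Permutation′ n) (f : GL L n) →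
    IsL[N]Generator L ν f ⇔ HasLeftInverse (λ i h → _•_ L (ν i) f h)
  generator⇔hasLeftInverse {m} {n} ν f = mk⇔
    (λ generates → (λ g → proj₁ (generates (δ g))) ,
                   λ g h → trans (sym (Σ≈∑ _ _)) (sym (proj₂ (generates (δ g)) h)))
    (λ (B , BM≈1) F → (λ i → ∑ (λ g → F g * B g i)) , λ h → sym (begin
      Σ[_] L m (λ i → ∑ (λ g → F g * B g i) * M i h) ≈⟨ Σ≈∑ m _ ⟩
      ∑ (λ i → ∑ (λ g → F g * B g i) * M i h)        ≈⟨ ∑-cong (λ i → *-distribʳ-∑ (M i h) (λ g → F g * B g i)) ⟩
      ∑ (λ i → ∑ (λ g → (F g * B g i) * M i h))      ≈⟨ ∑-swap (λ i g → (F g * B g i) * M i h) ⟩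
      ∑ (λ g → ∑ (λ i → (F g * B g i) * M i h))
        ≈⟨ ∑-cong (λ g → trans (∑-cong (λ i → *-assoc (F g) _ _)) (sym (*-distribˡ-∑ (F g) _))) ⟩
      ∑ (λ g → F g * (B *ᴹ M) g h)                   ≈⟨ ∑-cong (λ g → *-congˡ (BM≈1 g h)) ⟩
      ∑ (λ g → F g * δ g h)                          ≈⟨ ∑-δʳ h F ⟩
      F h                                            ∎))
    where
    M : Matrix L m n
    M i h = _•_ L (ν i) f h

module Regular {n} {G : FinGroup n} {m} (N : RegularNormalizedSubgroup G m) where
  open FinGroup G using (ε)
  open RegularNormalizedSubgroup N

  inverse-index : Fin m → Fin m
  inverse-index i = proj₁ (closed-⁻¹ i)

  ν-inverse-index : ∀ i g → ν (inverse-index i) ⟨$⟩ʳ g ≡ ν i ⟨$⟩ˡ g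
  ν-inverse-index i = proj₂ (closed-⁻¹ i)

  inverse-index-involutive : ∀ i → inverse-index (inverse-index i) ≡ i
  inverse-index-involutive i = ν-injective _ i λ g → begin
    ν i′′ ⟨$⟩ʳ g                           ≡⟨ ν-inverse-index i′ g ⟩
    ν i′ ⟨$⟩ˡ g                            ≡⟨ inverseʳ (ν i) ⟨
    ν i ⟨$⟩ʳ (ν i ⟨$⟩ˡ (ν i′ ⟨$⟩ˡ g))      ≡⟨ ≡.cong (ν i ⟨$⟩ʳ_) (ν-inverse-index i _) ⟨
    ν i ⟨$⟩ʳ (ν i′ ⟨$⟩ʳ (ν i′ ⟨$⟩ˡ g))     ≡⟨ ≡.cong (ν i ⟨$⟩ʳ_) (inverseʳ (ν i′)) ⟩
    ν i ⟨$⟩ʳ g                             ∎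
    where
    open ≡.≡-Reasoning
    i′ = inverse-index i
    i′′ = inverse-index i′

  inversion : Permutation′ m
  inversion = permutation inverse-index inverse-index inverse-index-involutive inverse-index-involutive

  orbit-injective : ∀ {i j} → ν i ⟨$⟩ʳ ε ≡ ν j ⟨$⟩ʳ ε → i ≡ j
  orbit-injective {i} {j} iε≡jε = ν-injective i j λ h → begin
    ν i ⟨$⟩ʳ h                       ≡⟨ inverseʳ (ν j) ⟨
    ν j ⟨$⟩ʳ (ν j ⟨$⟩ˡ (ν i ⟨$⟩ʳ h)) ≡⟨ ≡.cong (ν j ⟨$⟩ʳ_) (ν-k h) ⟨
    ν j ⟨$⟩ʳ (ν k ⟨$⟩ʳ h)            ≡⟨ ≡.cong (ν j ⟨$⟩ʳ_) (free k ε ν-k-fixes-ε h) ⟩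
    ν j ⟨$⟩ʳ h                       ∎
    where
    open ≡.≡-Reasoning
    k : Fin m
    k = proj₁ (closed-∘ (inverse-index j) i)
    ν-k : ∀ g → ν k ⟨$⟩ʳ g ≡ ν j ⟨$⟩ˡ (ν i ⟨$⟩ʳ g)
    ν-k g = ≡.trans (proj₂ (closed-∘ (inverse-index j) i) g) (ν-inverse-index j _)
    ν-k-fixes-ε : ν k ⟨$⟩ʳ ε ≡ ε
    ν-k-fixes-ε = ≡.trans (ν-k ε) (≡.trans (≡.cong (ν j ⟨$⟩ˡ_) iε≡jε) (inverseˡ (ν j)))

  |N|≡|G| : m ≡ n
  |N|≡|G| = cantor-schröder-bernstein {f = λ i → ν i ⟨$⟩ʳ ε} {g = λ g → proj₁ (transitive ε g)}
    orbit-injective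
    (λ {g} {h} e → ≡.trans (≡.sym (proj₂ (transitive ε g)))
                           (≡.trans (≡.cong (λ i → ν i ⟨$⟩ʳ ε) e) (proj₂ (transitive ε h))))

mainTheorem7 : ∀ {c ℓ : Level} (L : Field c ℓ) {n : ℕ} (G : FinGroup n) →
    NonAbelian G → (σ : GaloisAction L G) →
    ∀ {m : ℕ} (N : RegularNormalizedSubgroup G m) (x : Field.Carrier L) →
    IsL[N]Generator L (RegularNormalizedSubgroup.ν N) (f[_] L σ x)
      ⇔ Nonsingular L (T[_]⟨_⟩ L σ N x)
mainTheorem7 L G _ σ N x =
  ⇔-trans (generator⇔hasLeftInverse L ν f)
  (⇔-trans (mk⇔ (hasLeftInverse-permuteRows L inversion T≈translates)
                (hasLeftInverse-permuteRows L inversion translates≈T))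
           (⇔-sym (nonsingular⇔hasLeftInverse L |N|≡|G| T)))
  where
  open Field L using (_≈_; reflexive; sym; trans)
  open GaloisAction σ using (act)
  open RegularNormalizedSubgroup N using (ν)
  open Regular N
  f = f[_] L σ x
  T = T[_]⟨_⟩ L σ N x
  translates≈T : ∀ i h → _•_ L (ν i) f h ≈ T (inverse-index i) h
  translates≈T i h = reflexive (≡.cong (λ g → act g x) (≡.sym (ν-inverse-index i h)))
  T≈translates : ∀ i h → T i h ≈ _•_ L (ν (inverse-index i)) f h
  T≈translates i h = sym (trans (translates≈T (inverse-index i) h)
                                (reflexive (≡.cong (λ j → T j h) (inverse-index-involutive i))))
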